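{- For each of the following sets $H$ of graphs, there exists a finite simple graph $G$ containing no member of $H$ as an induced subgraph whose chromatic symmetric function $X_G$ is not $e$-positive: $H=\{\text{claw},K_4,4K_1\}$, $H=\{\text{claw},C_4,2K_2\}$, $H=\{\text{claw},\text{co-claw}\}$.
   Context: For a finite simple graph $G$ with vertex set $\{v_1,\dots,v_N\}$, $X_G=\sum_{\kappa} x_{\kappa(v_1)}\cdots x_{\kappa(v_N)}$, summed over all proper colorings $\kappa:V\to\mathbb{Z}^+$. A symmetric function is $e$-positive if it is a nonnegative linear combination of elementary symmetric functions $e_\lambda$. Claw $=K_{1,3}$; $K_4$ complete graph; $4K_1$ four isolated vertices; $C_4$ the 4-cycle; $2K_2$ two disjoint edges; co-claw $=$ a triangle plus an isolated vertex. -}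

module Defs where

open import Data.Bool using (Bool; true; false; _∧_; _∨_; not; if_then_else_)
open import Data.Bool.Properties using (∨-comm)
open import Data.Nat using (ℕ; zero; suc; _∸_; _≡ᵇ_; _≤ᵇ_)
open import Data.Fin using (Fin; zero; suc; _≟_)
open import Data.List using (List; []; _∷_; [_]; map; concatMap; allFin)
open import Data.Bool.ListAction using (and; all)
open import Data.Nat.ListAction using (sum)
open import Data.List.Relation.Unary.All using (All)
open import Data.Product using (Σ; ∃; _×_; _,_)
open import Data.Integer using (+_)
open import Data.Rational using (ℚ; _/_; 0ℚ; _≤_)
import Data.Rational as ℚ
open import Relation.Nullary using (¬_)
open import Relation.Nullary.Decidable using (isYes)
open import Relation.Binary.PropositionalEquality using (_≡_; _≢_; refl)

record Graph (N : ℕ) : Set where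
  field
    adj    : Fin N → Fin N → Bool
    sym    : ∀ u v → adj u v ≡ adj v u
    irrefl : ∀ v → adj v v ≡ false
open Graph public

_≤ind_ : ∀ {k N} → Graph k → Graph N → Set
_≤ind_ {k} {N} H G =
  Σ (Fin k → Fin N) λ f →
    (∀ u v → f u ≡ f v → u ≡ v) × (∀ u v → adj H u v ≡ adj G (f u) (f v))

allFuns : ∀ {B : Set} (k : ℕ) → List B → List (Fin k → B)
allFuns zero    xs = [ (λ ()) ]
allFuns {B} (suc k) xs = concatMap (λ f → map (λ c → cons c f) xs) (allFuns k xs)
  where
  cons : B → (Fin k → B) → Fin (suc k) → B
  cons c f zero    = c
  cons c f (suc i) = f i

countB : ∀ {A : Set} → (A → Bool) → List A → ℕ
countB p []       = 0
countB p (x ∷ xs) = if p x then suc (countB p xs) else countB p xs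

_==F_ : ∀ {n} → Fin n → Fin n → Bool
i ==F j = isYes (i ≟ j)

ℕtoℚ : ℕ → ℚ
ℕtoℚ k = (+ k) / 1

-- Chromatic symmetric function, coefficient of the monomial
-- x_1^{a_1} ... x_n^{a_n} (restriction to n variables):
-- number of proper colorings κ : V → {1..n} with |κ⁻¹(i)| = a_i.

proper : ∀ {N n} → Graph N → (Fin N → Fin n) → Bool
proper {N} G κ =
  and (concatMap (λ u → map (λ v → not (adj G u v) ∨ not (κ u ==F κ v)) (allFin N)) (allFin N))

hasType : ∀ {N n} → (Fin N → Fin n) → (Fin n → ℕ) → Bool
hasType {N} {n} κ a =
  and (map (λ i → countB (λ v → κ v ==F i) (allFin N) ≡ᵇ a i) (allFin n))

coefX : ∀ {N} → Graph N → (n : ℕ) → (Fin n → ℕ) → ℕ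
coefX {N} G n a = countB (λ κ → proper G κ ∧ hasType κ a) (allFuns N (allFin n))

-- Elementary symmetric functions e_μ = e_{μ_1} ⋯ e_{μ_l}, coefficient of
-- x_1^{a_1} ... x_n^{a_n}: number of tuples (S_1,…,S_l) of subsets of
-- {1..n} with |S_j| = μ_j such that each i lies in exactly a_i of the S_j.

size : ∀ {n} → (Fin n → Bool) → ℕ
size {n} S = countB S (allFin n)

ind : Bool → ℕ
ind true  = 1
ind false = 0

coefE : (n : ℕ) → List ℕ → (Fin n → ℕ) → ℕ
coefE n []      a = if all (λ i → a i ≡ᵇ 0) (allFin n) then 1 else 0
coefE n (m ∷ μ) a =
  sum (map (λ S → if (size S ≡ᵇ m) ∧ all (λ i → ind (S i) ≤ᵇ a i) (allFin n)
                  then coefE n μ (λ i → a i ∸ ind (S i)) else 0)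
           (allFuns n (true ∷ false ∷ [])))

-- e-positivity: X_G equals a finite nonnegative (rational) linear
-- combination Σ c_k e_{μ_k} of elementary symmetric functions (μ_k lists of
-- positive parts), i.e. all monomial coefficients agree in every number
-- n of variables.

ePositive : ∀ {N} → Graph N → Set
ePositive G =
  Σ (List (ℚ × List ℕ)) λ L →
    All (λ { (c , μ) → (0ℚ ≤ c) × All (λ m → 1 Data.Nat.≤ m) μ }) L ×
    (∀ (n : ℕ) (a : Fin n → ℕ) →
       ℕtoℚ (coefX G n a) ≡ ℚsum (map (λ { (c , μ) → c ℚ.* ℕtoℚ (coefE n μ a) }) L))
  where
  ℚsum : List ℚ → ℚ
  ℚsum []       = 0ℚ
  ℚsum (x ∷ xs) = x ℚ.+ ℚsum xs

f0 f1 f2 f3 : Fin 4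
f0 = zero
f1 = suc zero
f2 = suc (suc zero)
f3 = suc (suc (suc zero))

edgeAdj : ∀ {N} → List (Fin N × Fin N) → Fin N → Fin N → Bool
edgeAdj []             u v = false
edgeAdj ((x , y) ∷ es) u v = ((x ==F u ∧ y ==F v) ∨ (x ==F v ∧ y ==F u)) ∨ edgeAdj es u v

edgeAdj-sym : ∀ {N} (es : List (Fin N × Fin N)) u v → edgeAdj es u v ≡ edgeAdj es v u
edgeAdj-sym []             u v = refl
edgeAdj-sym ((x , y) ∷ es) u v
  rewrite ∨-comm ((x ==F u ∧ y ==F v)) ((x ==F v ∧ y ==F u)) | edgeAdj-sym es u v = refl

graph4 : (es : List (Fin 4 × Fin 4)) →
         edgeAdj es f0 f0 ≡ false → edgeAdj es f1 f1 ≡ false →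
         edgeAdj es f2 f2 ≡ false → edgeAdj es f3 f3 ≡ false → Graph 4
graph4 es p0 p1 p2 p3 = record
  { adj = edgeAdj es
  ; sym = edgeAdj-sym es
  ; irrefl = λ { zero → p0 ; (suc zero) → p1 ; (suc (suc zero)) → p2 ; (suc (suc (suc zero))) → p3 }
  }

claw : Graph 4
claw = graph4 ((f0 , f1) ∷ (f0 , f2) ∷ (f0 , f3) ∷ []) refl refl refl refl

K4 : Graph 4
K4 = graph4 ((f0 , f1) ∷ (f0 , f2) ∷ (f0 , f3) ∷ (f1 , f2) ∷ (f1 , f3) ∷ (f2 , f3) ∷ []) refl refl refl refl

4K1 : Graph 4
4K1 = graph4 [] refl refl refl refl

C4 : Graph 4
C4 = graph4 ((f0 , f1) ∷ (f1 , f2) ∷ (f2 , f3) ∷ (f3 , f0) ∷ []) refl refl refl refl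

2K2 : Graph 4
2K2 = graph4 ((f0 , f1) ∷ (f2 , f3) ∷ []) refl refl refl refl

co-claw : Graph 4
co-claw = graph4 ((f0 , f1) ∷ (f0 , f2) ∷ (f1 , f2) ∷ []) refl refl refl refl

Free : ∀ {N} → List (Graph 4) → Graph N → Set
Free Hs G = All (λ H → ¬ (H ≤ind G)) Hs

module Submission where

-- The net N (a triangle with one pendant vertex at each corner) witnesses all three claims.
--
-- Induced-subgraph containment between finite graphs is decidable, by searching the
-- finitely many vertex maps; running this decision procedure shows that N contains none of claw,
-- K₄, 4K₁, C₄, 2K₂, co-claw.
--
-- In three variables consider the linear functional
--   φ(f) = [x²y²z²]f + 3[x⁴yz]f + 3[x³y³]f − 3[x³y²z]f.
-- φ(X_N) = 12 − 18 < 0, while φ(e_μ) ≥ 0 for every μ; hence no nonnegative combination of the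
-- e_μ equals X_N.  To see φ(e_μ) ≥ 0 for the infinitely many μ, note that the coefficients of
-- e_{m ∷ μ} = e_m · e_μ at p only involve those of e_μ at p minus a subset of the variables.  So
-- on a finite window of exponents closed under such removals, the table of coefficients of e_μ
-- is obtained by iterating one operation on finite tables; the tables reachable from that of
-- e_[] form a finite list (those of e₁^a e₂^b e₃^c of degree ≤ 6, and the zero table of e₄),
-- and φ is checked to be nonnegative on each of them.

open import Defs hiding (sym)
open import Data.Bool using (Bool; true; false; _∧_; if_then_else_)
import Data.Bool.Properties as BoolP
open import Data.Bool.ListAction using (and; all)
open import Data.Nat using (ℕ; zero; suc; _+_; _*_; _∸_; _≡ᵇ_; _≤ᵇ_; _≤?_; s≤s)
import Data.Nat as ℕ
import Data.Nat.Properties as ℕP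
open import Data.Nat.ListAction using (sum)
open import Data.Fin using (Fin; zero; suc; _≟_; #_)
import Data.Fin.Properties as FinP
open import Data.Vec using (Vec; []; _∷_; lookup; tabulate)
import Data.Vec as Vec
import Data.Vec.Properties as VecP
open import Data.List using (List; []; _∷_; _++_; map; concatMap; filter; upTo; allFin; replicate)
open import Data.List.Properties using (map-cong; map-cong-local)
import Data.List.Properties as ListP
open import Data.List.Relation.Unary.All as All using (All; []; _∷_)
open import Data.List.Relation.Unary.Any as Any using (Any; here; there; any?)
open import Data.List.Relation.Unary.Any.Properties using (map⁺; concatMap⁺)
open import Data.List.Membership.Propositional using (_∈_)
open import Data.List.Membership.Propositional.Properties using (∈-allFin; ∈-upTo⁺)
import Data.List.Membership.DecPropositional as DecMembership
open import Data.Product using (Σ; _×_; _,_; proj₁)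
import Data.Product.Properties as ×P
open import Data.Rational using (ℚ; 0ℚ; _≤_; _<_)
import Data.Rational as ℚ
import Data.Rational.Properties as ℚP
open import Data.Rational.Solver using (module +-*-Solver)
open import Function using (_∘_)
open import Relation.Nullary using (¬_; Dec; yes; no; ¬?; contradiction)
open import Relation.Nullary.Decidable using (True; _×-dec_; _→-dec_; toWitness)
open import Relation.Binary using (DecidableEquality)
open import Relation.Binary.PropositionalEquality using (_≡_; refl; sym; trans; cong; cong₂; subst; _≗_; module ≡-Reasoning)

allFuns-complete : ∀ {B : Set} k (xs : List B) (f : Fin k → B) → (∀ i → f i ∈ xs) →
                   Any (_≗ f) (allFuns k xs)
allFuns-complete zero    xs f f∈ = here (λ ())
allFuns-complete (suc k) xs f f∈ =
  concatMap⁺ _ (Any.map (λ g≗ → map⁺ (Any.map (λ { refl → λ { zero → refl ; (suc i) → g≗ i } }) (f∈ zero)))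
                      (allFuns-complete k xs (f ∘ suc) (f∈ ∘ suc)))

IsEmbedding : ∀ {k N} → Graph k → Graph N → (Fin k → Fin N) → Set
IsEmbedding H G g = (∀ u v → g u ≡ g v → u ≡ v) × (∀ u v → adj H u v ≡ adj G (g u) (g v))

embedding? : ∀ {k N} (H : Graph k) (G : Graph N) g → Dec (IsEmbedding H G g)
embedding? H G g =
  FinP.all? (λ u → FinP.all? (λ v → (g u ≟ g v) →-dec (u ≟ v))) ×-dec
  FinP.all? (λ u → FinP.all? (λ v → adj H u v BoolP.≟ adj G (g u) (g v)))

embedding-≗ : ∀ {k N} {H : Graph k} {G : Graph N} {f g} → g ≗ f → IsEmbedding H G f → IsEmbedding H G g
embedding-≗ {G = G} g≗f (inj , pres) =
  (λ u v e → inj u v (trans (sym (g≗f u)) (trans e (g≗f v)))) ,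
  (λ u v → trans (pres u v) (sym (cong₂ (adj G) (g≗f u) (g≗f v))))

_≤ind?_ : ∀ {k N} (H : Graph k) (G : Graph N) → Dec (H ≤ind G)
_≤ind?_ {k} {N} H G with any? (embedding? H G) (allFuns k (allFin N))
... | yes found = yes (Any.satisfied found)
... | no none = no λ { (f , e) → none (Any.map (λ g≗f → embedding-≗ {H = H} {G = G} g≗f e)
                                     (allFuns-complete k (allFin N) f (λ i → ∈-allFin (f i)))) }

net : Graph 6
net = record { adj = edgeAdj netEdges ; sym = edgeAdj-sym netEdges ; irrefl = noLoop }
  where
  netEdges : List (Fin 6 × Fin 6)
  netEdges = (# 0 , # 1) ∷ (# 0 , # 2) ∷ (# 1 , # 2) ∷ (# 0 , # 3) ∷ (# 1 , # 4) ∷ (# 2 , # 5) ∷ []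
  noLoop : ∀ v → edgeAdj netEdges v v ≡ false
  noLoop zero = refl
  noLoop (suc zero) = refl
  noLoop (suc (suc zero)) = refl
  noLoop (suc (suc (suc zero))) = refl
  noLoop (suc (suc (suc (suc zero)))) = refl
  noLoop (suc (suc (suc (suc (suc zero))))) = refl

free? : ∀ {N} (Hs : List (Graph 4)) (G : Graph N) → Dec (Free Hs G)
free? Hs G = All.all? (λ H → ¬? (H ≤ind? G)) Hs

net-free : (Hs : List (Graph 4)) → {True (free? Hs net)} → Free Hs net
net-free Hs {ok} = toWitness ok

eCoef : ∀ {n} → List ℕ → Vec ℕ n → ℕ
eCoef {n} μ p = coefE n μ (lookup p)

subsets : (n : ℕ) → List (Fin n → Bool)
subsets n = allFuns n (true ∷ false ∷ [])

_⊖_ : ∀ {n} → Vec ℕ n → (Fin n → Bool) → Vec ℕ n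
p ⊖ S = tabulate (λ i → lookup p i ∸ ind (S i))

coefE-cong : ∀ n μ {a b : Fin n → ℕ} → a ≗ b → coefE n μ a ≡ coefE n μ b
coefE-cong n []      a≗b = cong (λ z → if z then 1 else 0) (cong and (map-cong (λ i → cong (_≡ᵇ 0) (a≗b i)) (allFin n)))
coefE-cong n (m ∷ μ) a≗b = cong sum (map-cong (λ S → cong₂ (λ z x → if z then x else 0)
  (cong (λ z → (size S ≡ᵇ m) ∧ z) (cong and (map-cong (λ i → cong (ind (S i) ≤ᵇ_) (a≗b i)) (allFin n))))
  (coefE-cong n μ (λ i → cong (_∸ ind (S i)) (a≗b i)))) (subsets n))

-- The coefficient of x^p in e_m · f, for f given by its coefficient function g.
mulCoef : ∀ {n} → ℕ → (Vec ℕ n → ℕ) → Vec ℕ n → ℕ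
mulCoef {n} m g p =
  sum (map (λ S → if (size S ≡ᵇ m) ∧ all (λ i → ind (S i) ≤ᵇ lookup p i) (allFin n) then g (p ⊖ S) else 0)
           (subsets n))

eCoef-cons : ∀ {n} m μ (p : Vec ℕ n) → eCoef (m ∷ μ) p ≡ mulCoef m (eCoef μ) p
eCoef-cons {n} m μ p =
  cong sum (map-cong (λ S → cong (λ x → if _ then x else 0) (coefE-cong n μ (sym ∘ VecP.lookup∘tabulate _))) (subsets n))

mulCoef-local : ∀ {n} m {g h : Vec ℕ n → ℕ} p → All (λ S → g (p ⊖ S) ≡ h (p ⊖ S)) (subsets n) →
                mulCoef m g p ≡ mulCoef m h p
mulCoef-local m p eqs = cong sum (map-cong-local (All.map (cong (λ x → if _ then x else 0)) eqs))

DownClosed : ∀ {n} → List (Vec ℕ n) → Set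
DownClosed {n} D = All (λ p → All (λ S → p ⊖ S ∈ D) (subsets n)) D

Table : ℕ → Set
Table n = List (Vec ℕ n × ℕ)

_≟ᵥ_ : ∀ {n} → DecidableEquality (Vec ℕ n)
_≟ᵥ_ = VecP.≡-dec ℕP._≟_

at : ∀ {n} → Table n → Vec ℕ n → ℕ
at []            p = 0
at ((q , x) ∷ T) p with q ≟ᵥ p
... | yes _ = x
... | no  _ = at T p

tabulateOn : ∀ {n} → List (Vec ℕ n) → (Vec ℕ n → ℕ) → Table n
tabulateOn D f = map (λ q → q , f q) D

at-tabulateOn : ∀ {n} (D : List (Vec ℕ n)) f {p} → p ∈ D → at (tabulateOn D f) p ≡ f p
at-tabulateOn (q ∷ D) f {p} p∈ with q ≟ᵥ p | p∈
... | yes refl | _          = refl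
... | no  q≢p  | here p≡q   = contradiction (sym p≡q) q≢p
... | no  _    | there p∈D  = at-tabulateOn D f p∈D

-- The table of e_μ on a window D, computed by multiplying in one e_m at a time; being a
-- finite list, each intermediate table is evaluated once.
timesE : ∀ {n} → List (Vec ℕ n) → ℕ → Table n → Table n
timesE D m T = tabulateOn D (mulCoef m (at T))

eTable : ∀ {n} → List (Vec ℕ n) → List ℕ → Table n
eTable D []      = tabulateOn D (eCoef [])
eTable D (m ∷ μ) = timesE D m (eTable D μ)

eTable-correct : ∀ {n} {D : List (Vec ℕ n)} → DownClosed D → ∀ μ {p} → p ∈ D → at (eTable D μ) p ≡ eCoef μ p
eTable-correct {D = D} closed []      p∈D = at-tabulateOn D (eCoef []) p∈D
eTable-correct {D = D} closed (m ∷ μ) {p} p∈D = begin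
  at (timesE D m (eTable D μ)) p  ≡⟨ at-tabulateOn D _ p∈D ⟩
  mulCoef m (at (eTable D μ)) p   ≡⟨ mulCoef-local m {at (eTable D μ)} {eCoef μ} p (All.map (eTable-correct closed μ) (All.lookup closed p∈D)) ⟩
  mulCoef m (eCoef μ) p           ≡⟨ eCoef-cons m μ p ⟨
  eCoef (m ∷ μ) p                 ∎
  where open ≡-Reasoning

-- Exponent vectors in three variables of degree at most 6 inside the box [0,4]×[0,3]×[0,2];
-- the box is large enough to contain the exponents 222, 411, 330 and 321 used below.
window : List (Vec ℕ 3)
window = filter (λ p → Vec.sum p ≤? 6) (box (4 ∷ 3 ∷ 2 ∷ []))
  where
  box : ∀ {n} → Vec ℕ n → List (Vec ℕ n)
  box []       = [] ∷ []
  box (b ∷ bs) = concatMap (λ x → map (x ∷_) (box bs)) (upTo (suc b))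

open DecMembership (_≟ᵥ_ {3}) using () renaming (_∈?_ to _∈-window?_)

window-closed : DownClosed window
window-closed = toWitness {a? = All.all? (λ p → All.all? (λ S → p ⊖ S ∈-window? window) (subsets 3)) window} _

-- The tables of e₁^a e₂^b e₃^c of degree at most 6, and of e₄, which vanishes in three variables.
tables : List (Table 3)
tables = map (eTable window) ((4 ∷ []) ∷ monomials)
  where
  monomials : List (List ℕ)
  monomials = concatMap (λ a → concatMap (λ b → concatMap (λ c →
      if a + 2 * b + 3 * c ≤ᵇ 6 then (replicate a 1 ++ replicate b 2 ++ replicate c 3) ∷ [] else [])
    (upTo 3)) (upTo 4)) (upTo 7)

open DecMembership (ListP.≡-dec (×P.≡-dec (_≟ᵥ_ {3}) ℕP._≟_)) using () renaming (_∈?_ to _∈-tables?_)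

tables-closed : All (λ T → All (λ m → timesE window m T ∈ tables) (upTo 5)) tables
tables-closed = toWitness {a? = All.all? (λ T → All.all? (λ m → timesE window m T ∈-tables? tables) (upTo 5)) tables} _

-- In three variables e_m = 0 for m ≥ 4, so multiplying by it always yields the zero table.
timesE-vanish : ∀ {m} → 4 ℕ.≤ m → ∀ T → timesE window m T ≡ timesE window 4 T
timesE-vanish (s≤s (s≤s (s≤s (s≤s _)))) T = refl

timesE-closed : ∀ m {T} → T ∈ tables → timesE window m T ∈ tables
timesE-closed m {T} T∈ with m ≤? 4
... | yes m≤4 = All.lookup (All.lookup tables-closed T∈) (∈-upTo⁺ (s≤s m≤4))
... | no  m≰4 = subst (_∈ tables) (sym (timesE-vanish (ℕP.<⇒≤ (ℕP.≰⇒> m≰4)) T))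
                      (All.lookup (All.lookup tables-closed T∈) (∈-upTo⁺ ℕP.≤-refl))

-- Hence the table of every e_μ on the window is one of the listed ones (e_[] = 1 is the
-- monomial with a = b = c = 0, listed second).
eTable-reachable : ∀ μ → eTable window μ ∈ tables
eTable-reachable []      = there (here refl)
eTable-reachable (m ∷ μ) = timesE-closed m (eTable-reachable μ)

x222 x411 x330 x321 : Vec ℕ 3
x222 = 2 ∷ 2 ∷ 2 ∷ []
x411 = 4 ∷ 1 ∷ 1 ∷ []
x330 = 3 ∷ 3 ∷ 0 ∷ []
x321 = 3 ∷ 2 ∷ 1 ∷ []

three : ℚ
three = ℕtoℚ 3

φ : (Vec ℕ 3 → ℚ) → ℚ
φ f = ((f x222 ℚ.+ three ℚ.* f x411) ℚ.+ three ℚ.* f x330) ℚ.- three ℚ.* f x321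

support : List (Vec ℕ 3)
support = x222 ∷ x411 ∷ x330 ∷ x321 ∷ []

φ-local : ∀ {f g} → All (λ p → f p ≡ g p) support → φ f ≡ φ g
φ-local (e₁ ∷ e₂ ∷ e₃ ∷ e₄ ∷ []) rewrite e₁ | e₂ | e₃ | e₄ = refl

support-in-window : All (_∈ window) support
support-in-window = toWitness {a? = All.all? (_∈-window? window) support} _

φ-linear : ∀ c f g → φ (λ p → c ℚ.* f p ℚ.+ g p) ≡ c ℚ.* φ f ℚ.+ φ g
φ-linear c f g = solve 9 (λ c f₁ f₂ f₃ f₄ g₁ g₂ g₃ g₄ →
    (((c :* f₁ :+ g₁) :+ con three :* (c :* f₂ :+ g₂)) :+ con three :* (c :* f₃ :+ g₃)) :- con three :* (c :* f₄ :+ g₄)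
  := c :* (((f₁ :+ con three :* f₂) :+ con three :* f₃) :- con three :* f₄) :+ (((g₁ :+ con three :* g₂) :+ con three :* g₃) :- con three :* g₄))
  refl c (f x222) (f x411) (f x330) (f x321) (g x222) (g x411) (g x330) (g x321)
  where open +-*-Solver

nonneg-* : ∀ {c x} → 0ℚ ≤ c → 0ℚ ≤ x → 0ℚ ≤ c ℚ.* x
nonneg-* {c} {x} c≥0 x≥0 = subst (_≤ c ℚ.* x) (ℚP.*-zeroʳ c) (ℚP.*-monoˡ-≤-nonNeg c {{ℚ.nonNegative c≥0}} x≥0)

φ-tables-nonneg : All (λ T → 0ℚ ≤ φ (ℕtoℚ ∘ at T)) tables
φ-tables-nonneg = toWitness {a? = All.all? (λ T → 0ℚ ℚP.≤? φ (ℕtoℚ ∘ at T)) tables} _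

φ-e-nonneg : ∀ μ → 0ℚ ≤ φ (ℕtoℚ ∘ eCoef μ)
φ-e-nonneg μ = subst (0ℚ ≤_)
  (φ-local (All.map (λ p∈ → cong ℕtoℚ (eTable-correct window-closed μ p∈)) support-in-window))
  (All.lookup φ-tables-nonneg (eTable-reachable μ))

-- φ is negative on the chromatic symmetric function of the net: 12 − 3·6 = −6.
φ-net-negative : φ (ℕtoℚ ∘ coefX net 3 ∘ lookup) < 0ℚ
φ-net-negative = toWitness {a? = φ (ℕtoℚ ∘ coefX net 3 ∘ lookup) ℚP.<? 0ℚ} _

Combination : Set
Combination = List (ℚ × List ℕ)

sumℚ : List ℚ → ℚ
sumℚ []       = 0ℚ
sumℚ (x ∷ xs) = x ℚ.+ sumℚ xs

Coefficients : Set
Coefficients = Combination → (n : ℕ) → (Fin n → ℕ) → ℚ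

coefficient : Coefficients
coefficient L n a = sumℚ (map (λ (c , μ) → c ℚ.* ℕtoℚ (coefE n μ a)) L)

coefficient-unique : (s : Coefficients) → (∀ n a → s [] n a ≡ 0ℚ) →
  (∀ c μ L n a → s ((c , μ) ∷ L) n a ≡ c ℚ.* ℕtoℚ (coefE n μ a) ℚ.+ s L n a) →
  ∀ L n a → s L n a ≡ coefficient L n a
coefficient-unique s nil cons []            n a = nil n a
coefficient-unique s nil cons ((c , μ) ∷ L) n a =
  trans (cons c μ L n a) (cong (c ℚ.* ℕtoℚ (coefE n μ a) ℚ.+_) (coefficient-unique s nil cons L n a))

Expansion : ∀ {N} → Graph N → (P : Combination → Set) → Coefficients → Set
Expansion G P s = Σ Combination λ L → P L × (∀ n a → ℕtoℚ (coefX G n a) ≡ s L n a)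

-- ePositive restated with `coefficient`.  The sum in the definition of ePositive is local to
-- Defs, but it obeys the recursion of coefficient-unique, so unification recovers it as s.
ePositive⇒expansion : ∀ {N} {G : Graph N} → ePositive G →
  Expansion G (All (λ t → 0ℚ ≤ proj₁ t)) coefficient
ePositive⇒expansion {G = G} e = normalise {G = G} _ _ (λ _ _ → refl) (λ _ _ _ _ _ → refl) e
  where
  normalise : ∀ {N} {G : Graph N} (P : List ℕ → Set) (s : Coefficients) → (∀ n a → s [] n a ≡ 0ℚ) →
    (∀ c μ L n a → s ((c , μ) ∷ L) n a ≡ c ℚ.* ℕtoℚ (coefE n μ a) ℚ.+ s L n a) →
    Expansion G (All (λ (c , μ) → (0ℚ ≤ c) × P μ)) s →
    Expansion G (All (λ t → 0ℚ ≤ proj₁ t)) coefficient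
  normalise _ s nil cons (L , pos , X≡) =
    L , All.map proj₁ pos , λ n a → trans (X≡ n a) (coefficient-unique s nil cons L n a)

φ-combination-nonneg : ∀ L → All (λ t → 0ℚ ≤ proj₁ t) L → 0ℚ ≤ φ (coefficient L 3 ∘ lookup)
φ-combination-nonneg []            []          = ℚP.≤-refl
φ-combination-nonneg ((c , μ) ∷ L) (c≥0 ∷ ≥0) =
  subst (0ℚ ≤_) (sym (φ-linear c (ℕtoℚ ∘ eCoef μ) (coefficient L 3 ∘ lookup)))
        (ℚP.+-mono-≤ (nonneg-* c≥0 (φ-e-nonneg μ)) (φ-combination-nonneg L ≥0))

-- φ(X_N) < 0 excludes 0 ≤ φ(X_N).  The implicit arguments are given so that unification never
-- unfolds the closed value φ(X_N).
φ-net-not-nonneg : ¬ 0ℚ ≤ φ (ℕtoℚ ∘ coefX net 3 ∘ lookup)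
φ-net-not-nonneg φX≥0 = ℚP.<-irrefl {φX} {φX} refl (ℚP.<-≤-trans {φX} {0ℚ} {φX} φ-net-negative φX≥0)
  where
  φX : ℚ
  φX = φ (ℕtoℚ ∘ coefX net 3 ∘ lookup)

net-not-e-positive : ¬ ePositive net
net-not-e-positive e = refute (ePositive⇒expansion {G = net} e)
  where
  refute : ¬ Expansion net (All (λ t → 0ℚ ≤ proj₁ t)) coefficient
  refute (L , nonneg , X≡) = φ-net-not-nonneg (subst (0ℚ ≤_)
    (φ-local {coefficient L 3 ∘ lookup} {ℕtoℚ ∘ coefX net 3 ∘ lookup} (All.tabulate λ {p} _ → sym (X≡ 3 (lookup p))))
    (φ-combination-nonneg L nonneg))

theorem9 :
    (Σ ℕ λ N → Σ (Graph N) λ G → Free (claw ∷ K4 ∷ 4K1 ∷ []) G × ¬ ePositive G) ×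
    (Σ ℕ λ N → Σ (Graph N) λ G → Free (claw ∷ C4 ∷ 2K2 ∷ []) G × ¬ ePositive G) ×
    (Σ ℕ λ N → Σ (Graph N) λ G → Free (claw ∷ co-claw ∷ []) G × ¬ ePositive G)
theorem9 =
  (6 , net , net-free (claw ∷ K4 ∷ 4K1 ∷ []) , net-not-e-positive) ,
  (6 , net , net-free (claw ∷ C4 ∷ 2K2 ∷ []) , net-not-e-positive) ,
  (6 , net , net-free (claw ∷ co-claw ∷ []) , net-not-e-positive)
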